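{- For every $\varepsilon>0$ and all integers $n\ge 2$, $s\ge 1$ there exist a positive integer $m$ and a non-empty set $X\subseteq\{0,1,\dots,m-1\}^n$ such that (i) for all $i\in[n]$, $AvgDeg_i(X)\ge s(n-\varepsilon)$; (ii) there is no non-empty $Y\subseteq X$ such that $MinDeg_i(Y)\ge s+1$ for all $i\in[n]$.
   Context: For a finite set $A$, $X\subseteq A^n$ and $S=\{i_1<\dots<i_k\}\subseteq[n]$, let $X_S=\{(x_{i_1},\dots,x_{i_k}):(x_1,\dots,x_n)\in X\}$. For $i\in[n]$, $G_i(X)$ is the bipartite graph with left vertex set $A$, right vertex set $X_{[n]\setminus\{i\}}$, and an edge between $a\in A$ and $(x_1,\dots,x_{i-1},x_{i+1},\dots,x_n)$ iff $(x_1,\dots,x_{i-1},a,x_{i+1},\dots,x_n)\in X$. $MinDeg_i(X)$ is the minimum degree of a right vertex of $G_i(X)$, and $AvgDeg_i(X)=|X|/|X_{[n]\setminus\{i\}}|$.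
   Formalization: The parameter ε ranges over the positive rationals. -}

module Defs where

open import Data.Nat using (ℕ; zero; suc; pred; _⊓_; _<ᵇ_)
open import Data.Bool using (Bool; T)
open import Data.Bool.Properties using (T?)
open import Data.Fin using (Fin)
open import Data.Vec using (Vec; []; _∷_; insertAt)
open import Data.List using (List; []; _∷_; [_]; map; concatMap; filterᵇ; length; allFin)
open import Data.Integer using (+_)
open import Data.Rational using (ℚ; _/_; 0ℚ)
open import Data.Product using (Σ; ∃; _×_)

SubsetOf : ℕ → ℕ → Set
SubsetOf m n = Vec (Fin m) n → Bool

_⊆ˢ_ : ∀ {m n} → SubsetOf m n → SubsetOf m n → Set
Y ⊆ˢ X = ∀ x → T (Y x) → T (X x)

NonEmpty : ∀ {m n} → SubsetOf m n → Set
NonEmpty X = ∃ λ x → T (X x)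

allVecs : (m n : ℕ) → List (Vec (Fin m) n)
allVecs m zero    = [ [] ]
allVecs m (suc n) = concatMap (λ a → map (a ∷_) (allVecs m n)) (allFin m)

card : ∀ {m n} → SubsetOf m n → ℕ
card {m} {n} X = length (filterᵇ X (allVecs m n))

ins : ∀ {m n} → Fin n → Vec (Fin m) (pred n) → Fin m → Vec (Fin m) n
ins {n = suc n} i w a = insertAt w i a

-- degree of the right vertex w in G_i(X)
deg : ∀ {m n} → SubsetOf m n → Fin n → Vec (Fin m) (pred n) → ℕ
deg {m} X i w = length (filterᵇ (λ a → X (ins i w a)) (allFin m))

proj : ∀ {m n} → SubsetOf m n → Fin n → SubsetOf m (pred n)
proj X i w = 0 <ᵇ deg X i w

-- minimum of a list (0 for the empty list; never used on empty lists
-- when X is non-empty)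
listMin : List ℕ → ℕ
listMin []       = 0
listMin (x ∷ []) = x
listMin (x ∷ xs@(_ ∷ _)) = x ⊓ listMin xs

MinDeg : ∀ {m n} → SubsetOf m n → Fin n → ℕ
MinDeg {m} {n} X i = listMin (map (deg X i) (filterᵇ (proj X i) (allVecs m (pred n))))

-- AvgDeg_i(X) = |X| / |X_{[n]∖{i}}|  (0 if X is empty)
avgAux : ℕ → ℕ → ℚ
avgAux a zero    = 0ℚ
avgAux a (suc k) = (+ a) / suc k

AvgDeg : ∀ {m n} → SubsetOf m n → Fin n → ℚ
AvgDeg X i = avgAux (card X) (card (proj X i))

module Submission where

-- Take X to be the slab of points of {0,…,m−1}ⁿ whose coordinate sum σ lies in [K, K + s n), with
-- m = K + s n. A line through a point with σ ≤ K meets X in s n points, and for K large almost every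
-- point of each projection of X has σ ≤ K, so every average degree is close to s n.
-- If Y ⊆ X is non-empty, let z maximise the potential σ² − (2K + s − 1)σ − 2s Σⱼ j xⱼ over Y; then
-- σ(z) lies in a block [K + s d, K + s d + s) with d < n, and along the line through z in direction d
-- the potential is a parabola whose sublevel set through z is that block, so this line carries at
-- most s points of Y.

module SlabConstruction where

  open import Defs
  open import Data.Nat
  open import Data.Nat.Properties
  open import Data.Nat.DivMod using (_/_; _%_; m≡m%n+[m/n]*n; m%n<n; m<n*o⇒m/o<n)
  open import Data.Nat.ListAction using (sum)
  open import Data.Nat.ListAction.Properties using (sum-++)
  open import Data.Nat.Tactic.RingSolver using (solve-∀)
  open import Algebra.Properties.CommutativeSemigroup +-commutativeSemigroup using (interchange)
  open import Data.Integer as ℤ using (ℤ)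
  import Data.Integer.Properties as ℤP
  import Data.Integer.Tactic.RingSolver as ZS
  open import Data.Rational as ℚ using (ℚ; mkℚ; 0ℚ; ↧ₙ_)
  import Data.Rational.Properties as ℚP
  import Data.Rational.Unnormalised as U
  import Data.Rational.Unnormalised.Properties as UP
  open import Data.Bool using (Bool; true; false; T; if_then_else_)
  open import Data.Bool.Properties using (T?)
  open import Data.Unit using (tt)
  open import Data.Empty using (⊥-elim)
  open import Data.Product using (_×_; _,_; proj₁; proj₂; Σ)
  open import Data.Fin using (Fin; zero; suc; toℕ; fromℕ<)
  open import Data.Fin.Properties using (toℕ-fromℕ<)
  open import Data.Vec using (Vec; []; _∷_; insertAt; removeAt; lookup; replicate)
  open import Data.Vec.Properties using (insertAt-removeAt)
  open import Data.List using (List; []; _∷_; _++_; map; concatMap; filterᵇ; length; allFin; tabulate)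
  open import Data.List.Properties using (map-++; map-cong; map-∘; map-tabulate)
  open import Data.List.Relation.Unary.Any as Any using (here; there)
  import Data.List.Relation.Unary.All as All
  open import Data.List.Relation.Unary.All.Properties using (all-filter)
  open import Data.List.Extrema ℤP.≤-totalOrder using (argmax; argmax-all; f[xs]≤f[argmax])
  open import Data.List.Membership.Propositional using (_∈_)
  open import Data.List.Membership.Propositional.Properties using (∈-map⁺; ∈-concatMap⁺; ∈-filter⁺; ∈-allFin)
  open import Function using (_∘_)
  open import Relation.Nullary using (¬_; yes; no)
  open import Relation.Nullary.Reflects using (ofʸ; ofⁿ)
  open import Relation.Binary.PropositionalEquality

  private
    variable
      A B : Set

  indicator : Bool → ℕ
  indicator true  = 1
  indicator false = 0

  indicator-mono : ∀ {b c} → (T b → T c) → indicator b ≤ indicator c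
  indicator-mono {false} _ = z≤n
  indicator-mono {true} {true} _ = ≤-refl
  indicator-mono {true} {false} b⇒c = ⊥-elim (b⇒c tt)

  length-filterᵇ : (P : A → Bool) (xs : List A) → length (filterᵇ P xs) ≡ sum (map (indicator ∘ P) xs)
  length-filterᵇ P [] = refl
  length-filterᵇ P (x ∷ xs) with P x
  ... | true  = cong suc (length-filterᵇ P xs)
  ... | false = length-filterᵇ P xs

  sum-map-cong : {f g : A → ℕ} → (∀ x → f x ≡ g x) → (xs : List A) → sum (map f xs) ≡ sum (map g xs)
  sum-map-cong f≗g xs = cong sum (map-cong f≗g xs)

  sum-map-∘ : (g : B → ℕ) (f : A → B) (xs : List A) → sum (map (g ∘ f) xs) ≡ sum (map g (map f xs))
  sum-map-∘ g f xs = cong sum (map-∘ xs)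

  sum-map-zero : (xs : List A) → sum (map (λ _ → 0) xs) ≡ 0
  sum-map-zero []       = refl
  sum-map-zero (x ∷ xs) = sum-map-zero xs

  sum-map-+ : (f g : A → ℕ) (xs : List A) → sum (map (λ x → f x + g x) xs) ≡ sum (map f xs) + sum (map g xs)
  sum-map-+ f g []       = refl
  sum-map-+ f g (x ∷ xs) = begin
    f x + g x + sum (map (λ x → f x + g x) xs) ≡⟨ cong (f x + g x +_) (sum-map-+ f g xs) ⟩
    f x + g x + (sum (map f xs) + sum (map g xs)) ≡⟨ interchange (f x) (g x) _ _ ⟩
    f x + sum (map f xs) + (g x + sum (map g xs)) ∎
    where open ≡-Reasoning

  sum-map-*ˡ : (c : ℕ) (f : A → ℕ) (xs : List A) → sum (map (λ x → c * f x) xs) ≡ c * sum (map f xs)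
  sum-map-*ˡ c f []       = sym (*-zeroʳ c)
  sum-map-*ˡ c f (x ∷ xs) = trans (cong (c * f x +_) (sum-map-*ˡ c f xs)) (sym (*-distribˡ-+ c (f x) _))

  sum-map-mono-≤ : {f g : A → ℕ} → (∀ x → f x ≤ g x) → (xs : List A) → sum (map f xs) ≤ sum (map g xs)
  sum-map-mono-≤ f≤g []       = z≤n
  sum-map-mono-≤ f≤g (x ∷ xs) = +-mono-≤ (f≤g x) (sum-map-mono-≤ f≤g xs)

  sum-map-concatMap : (g : B → ℕ) (f : A → List B) (xs : List A) →
    sum (map g (concatMap f xs)) ≡ sum (map (λ x → sum (map g (f x))) xs)
  sum-map-concatMap g f []       = refl
  sum-map-concatMap g f (x ∷ xs) = begin
    sum (map g (f x ++ concatMap f xs))              ≡⟨ cong sum (map-++ g (f x) _) ⟩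
    sum (map g (f x) ++ map g (concatMap f xs))      ≡⟨ sum-++ (map g (f x)) _ ⟩
    sum (map g (f x)) + sum (map g (concatMap f xs)) ≡⟨ cong (sum (map g (f x)) +_) (sum-map-concatMap g f xs) ⟩
    sum (map g (f x)) + sum (map (λ x → sum (map g (f x))) xs) ∎
    where open ≡-Reasoning

  sum-map-comm : (f : A → B → ℕ) (xs : List A) (ys : List B) →
    sum (map (λ x → sum (map (f x) ys)) xs) ≡ sum (map (λ y → sum (map (λ x → f x y) xs)) ys)
  sum-map-comm f []       ys = sym (sum-map-zero ys)
  sum-map-comm f (x ∷ xs) ys = trans (cong (sum (map (f x) ys) +_) (sum-map-comm f xs ys)) (sym (sum-map-+ (f x) _ ys))

  sum-indicator-pos : (P : A → Bool) {xs : List A} {x : A} → x ∈ xs → T (P x) → 1 ≤ sum (map (indicator ∘ P) xs)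
  sum-indicator-pos P {y ∷ _} (here refl) Px with P y
  ... | true = s≤s z≤n
  sum-indicator-pos P {y ∷ _} (there x∈xs) Px = ≤-trans (sum-indicator-pos P x∈xs Px) (m≤n+m _ (indicator (P y)))

  listMin-≤ : (xs : List ℕ) {x : ℕ} → x ∈ xs → listMin xs ≤ x
  listMin-≤ (y ∷ [])     (here refl) = ≤-refl
  listMin-≤ (y ∷ z ∷ xs) (here refl) = m⊓n≤m y _
  listMin-≤ (y ∷ z ∷ xs) (there x∈) = ≤-trans (m⊓n≤n y _) (listMin-≤ (z ∷ xs) x∈)

  ∈-allVecs : ∀ {m n} (x : Vec (Fin m) n) → x ∈ allVecs m n
  ∈-allVecs []      = here refl
  ∈-allVecs {m} {suc n} (a ∷ x) =
    ∈-concatMap⁺ (λ b → map (b ∷_) (allVecs m n)) (Any.map (λ { refl → ∈-map⁺ (a ∷_) (∈-allVecs x) }) (∈-allFin a))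

  sum-allVecs-insertAt : ∀ {m n} (i : Fin (suc n)) (f : Vec (Fin m) (suc n) → ℕ) →
    sum (map f (allVecs m (suc n))) ≡
    sum (map (λ w → sum (map (λ a → f (insertAt w i a)) (allFin m))) (allVecs m n))
  sum-allVecs-insertAt {m} {n} zero f = begin
    sum (map f (concatMap (λ a → map (a ∷_) (allVecs m n)) (allFin m)))
      ≡⟨ sum-map-concatMap f _ (allFin m) ⟩
    sum (map (λ a → sum (map f (map (a ∷_) (allVecs m n)))) (allFin m))
      ≡⟨ sum-map-cong (λ a → sym (sum-map-∘ f (a ∷_) (allVecs m n))) (allFin m) ⟩
    sum (map (λ a → sum (map (λ w → f (a ∷ w)) (allVecs m n))) (allFin m))
      ≡⟨ sum-map-comm (λ a w → f (a ∷ w)) (allFin m) (allVecs m n) ⟩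
    sum (map (λ w → sum (map (λ a → f (a ∷ w)) (allFin m))) (allVecs m n)) ∎
    where open ≡-Reasoning
  sum-allVecs-insertAt {m} {suc n} (suc i) f = begin
    sum (map f (concatMap (λ b → map (b ∷_) (allVecs m (suc n))) (allFin m)))
      ≡⟨ sum-map-concatMap f _ (allFin m) ⟩
    sum (map (λ b → sum (map f (map (b ∷_) (allVecs m (suc n))))) (allFin m))
      ≡⟨ sum-map-cong (λ b → trans (sym (sum-map-∘ f (b ∷_) (allVecs m (suc n))))
                                   (sum-allVecs-insertAt i (λ v → f (b ∷ v)))) (allFin m) ⟩
    sum (map (λ b → sum (map (λ w → g (b ∷ w)) (allVecs m n))) (allFin m))
      ≡⟨ sum-map-cong (λ b → sum-map-∘ g (b ∷_) (allVecs m n)) (allFin m) ⟩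
    sum (map (λ b → sum (map g (map (b ∷_) (allVecs m n)))) (allFin m))
      ≡⟨ sum-map-concatMap g _ (allFin m) ⟨
    sum (map g (allVecs m (suc n))) ∎
    where
    open ≡-Reasoning
    g : Vec (Fin m) (suc n) → ℕ
    g w = sum (map (λ a → f (insertAt w (suc i) a)) (allFin m))

  card≡sum-deg : ∀ {m n} (X : SubsetOf m (suc n)) (i : Fin (suc n)) → card X ≡ sum (map (deg X i) (allVecs m n))
  card≡sum-deg {m} {n} X i = begin
    card X                                        ≡⟨ length-filterᵇ X (allVecs m (suc n)) ⟩
    sum (map (indicator ∘ X) (allVecs m (suc n))) ≡⟨ sum-allVecs-insertAt i (indicator ∘ X) ⟩
    sum (map (λ w → sum (map (λ a → indicator (X (insertAt w i a))) (allFin m))) (allVecs m n))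
      ≡⟨ sum-map-cong (λ w → length-filterᵇ (λ a → X (insertAt w i a)) (allFin m)) (allVecs m n) ⟨
    sum (map (deg X i) (allVecs m n)) ∎
    where open ≡-Reasoning

  MinDeg≤deg : ∀ {m n} (X : SubsetOf m (suc n)) (i : Fin (suc n)) (w : Vec (Fin m) n) →
    1 ≤ deg X i w → MinDeg X i ≤ deg X i w
  MinDeg≤deg {m} {n} X i w deg≥1 =
    listMin-≤ _ (∈-map⁺ (deg X i) (∈-filter⁺ (T? ∘ proj X i) (∈-allVecs w) (<⇒<ᵇ deg≥1)))

  sumBelow : ℕ → (ℕ → ℕ) → ℕ
  sumBelow zero    g = 0
  sumBelow (suc m) g = g 0 + sumBelow m (g ∘ suc)

  sum-map-allFin : ∀ m (g : ℕ → ℕ) → sum (map (g ∘ toℕ) (allFin m)) ≡ sumBelow m g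
  sum-map-allFin zero    g = refl
  sum-map-allFin (suc m) g = cong (g 0 +_) (begin
    sum (map (g ∘ toℕ) (tabulate {n = m} suc)) ≡⟨ cong sum (map-tabulate {n = m} suc (g ∘ toℕ)) ⟩
    sum (tabulate {n = m} (g ∘ suc ∘ toℕ))     ≡⟨ cong sum (map-tabulate {n = m} (λ i → i) (g ∘ suc ∘ toℕ)) ⟨
    sum (map ((g ∘ suc) ∘ toℕ) (allFin m))      ≡⟨ sum-map-allFin m (g ∘ suc) ⟩
    sumBelow m (g ∘ suc) ∎)
    where open ≡-Reasoning

  sumBelow-cong : ∀ m {f g : ℕ → ℕ} → (∀ j → f j ≡ g j) → sumBelow m f ≡ sumBelow m g
  sumBelow-cong zero    f≗g = refl
  sumBelow-cong (suc m) f≗g = cong₂ _+_ (f≗g 0) (sumBelow-cong m (f≗g ∘ suc))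

  sumBelow-zero : ∀ m → sumBelow m (λ _ → 0) ≡ 0
  sumBelow-zero zero    = refl
  sumBelow-zero (suc m) = sumBelow-zero m

  inRange : ℕ → ℕ → ℕ → Bool
  inRange zero     zero      j       = false
  inRange zero     (suc len) zero    = true
  inRange zero     (suc len) (suc j) = inRange zero len j
  inRange (suc lo) len       zero    = false
  inRange (suc lo) len       (suc j) = inRange lo len j

  inRange-sound : ∀ lo len j → T (inRange lo len j) → lo ≤ j × j < lo + len
  inRange-sound zero     (suc len) zero    _ = z≤n , s≤s z≤n
  inRange-sound zero     (suc len) (suc j) t = z≤n , s≤s (proj₂ (inRange-sound zero len j t))
  inRange-sound (suc lo) len       (suc j) t = let (lo≤j , j<) = inRange-sound lo len j t in s≤s lo≤j , s≤s j<

  inRange-complete : ∀ lo len j → lo ≤ j → j < lo + len → T (inRange lo len j)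
  inRange-complete zero     (suc len) zero    _        _         = tt
  inRange-complete zero     (suc len) (suc j) _        (s≤s j<)  = inRange-complete zero len j z≤n j<
  inRange-complete (suc lo) len       (suc j) (s≤s lo≤j) (s≤s j<) = inRange-complete lo len j lo≤j j<

  inRange-+ : ∀ d lo len j → inRange (d + lo) len (d + j) ≡ inRange lo len j
  inRange-+ zero    lo len j = refl
  inRange-+ (suc d) lo len j = inRange-+ d lo len j

  count-inRange-≤ : ∀ m lo len → sumBelow m (indicator ∘ inRange lo len) ≤ len
  count-inRange-≤ zero    lo       len       = z≤n
  count-inRange-≤ (suc m) (suc lo) len       = count-inRange-≤ m lo len
  count-inRange-≤ (suc m) zero     zero      = ≤-reflexive (sumBelow-zero m)
  count-inRange-≤ (suc m) zero     (suc len) = s≤s (count-inRange-≤ m zero len)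

  count-inRange : ∀ m lo len → lo + len ≤ m → sumBelow m (indicator ∘ inRange lo len) ≡ len
  count-inRange zero    zero     zero      _         = refl
  count-inRange (suc m) (suc lo) len       (s≤s ≤m)  = count-inRange m lo len ≤m
  count-inRange (suc m) zero     zero      _         = sumBelow-zero m
  count-inRange (suc m) zero     (suc len) (s≤s ≤m)  = cong suc (count-inRange m zero len ≤m)

  coordSum : ∀ {m k} → Vec (Fin m) k → ℕ
  coordSum []      = 0
  coordSum (a ∷ w) = toℕ a + coordSum w

  coordSum-insertAt : ∀ {m k} (w : Vec (Fin m) k) (i : Fin (suc k)) (a : Fin m) →
    coordSum (insertAt w i a) ≡ coordSum w + toℕ a
  coordSum-insertAt w       zero    a = +-comm (toℕ a) (coordSum w)
  coordSum-insertAt (b ∷ w) (suc i) a =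
    trans (cong (toℕ b +_) (coordSum-insertAt w i a)) (sym (+-assoc (toℕ b) (coordSum w) (toℕ a)))

  weightedSum : ∀ {m k} → ℕ → Vec (Fin m) k → ℕ
  weightedSum o []      = 0
  weightedSum o (a ∷ w) = o * toℕ a + weightedSum (suc o) w

  -- The two weighted sums differ by (o + i)(a − b); the statement avoids subtraction.
  weightedSum-insertAt : ∀ {m k} o (w : Vec (Fin m) k) (i : Fin (suc k)) (a b : Fin m) →
    weightedSum o (insertAt w i a) + (o + toℕ i) * toℕ b ≡ weightedSum o (insertAt w i b) + (o + toℕ i) * toℕ a
  weightedSum-insertAt o w zero a b = swap-terms o (toℕ a) (toℕ b) (weightedSum (suc o) w)
    where
    swap-terms : ∀ o a b r → o * a + r + (o + 0) * b ≡ o * b + r + (o + 0) * a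
    swap-terms = solve-∀
  weightedSum-insertAt o (c ∷ w) (suc i) a b = begin
    o * toℕ c + weightedSum (suc o) (insertAt w i a) + (o + suc (toℕ i)) * toℕ b
      ≡⟨ cong (λ p → o * toℕ c + weightedSum (suc o) (insertAt w i a) + p * toℕ b) (+-suc o (toℕ i)) ⟩
    o * toℕ c + weightedSum (suc o) (insertAt w i a) + (suc o + toℕ i) * toℕ b
      ≡⟨ +-assoc (o * toℕ c) _ _ ⟩
    o * toℕ c + (weightedSum (suc o) (insertAt w i a) + (suc o + toℕ i) * toℕ b)
      ≡⟨ cong (o * toℕ c +_) (weightedSum-insertAt (suc o) w i a b) ⟩
    o * toℕ c + (weightedSum (suc o) (insertAt w i b) + (suc o + toℕ i) * toℕ a)
      ≡⟨ +-assoc (o * toℕ c) _ _ ⟨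
    o * toℕ c + weightedSum (suc o) (insertAt w i b) + (suc o + toℕ i) * toℕ a
      ≡⟨ cong (λ p → o * toℕ c + weightedSum (suc o) (insertAt w i b) + p * toℕ a) (+-suc o (toℕ i)) ⟨
    o * toℕ c + weightedSum (suc o) (insertAt w i b) + (o + suc (toℕ i)) * toℕ a ∎
    where open ≡-Reasoning

  -- simplex k N = (N + k) choose k, the number of k-tuples of naturals with sum at most N.
  simplex : ℕ → ℕ → ℕ
  simplex zero    N       = 1
  simplex (suc k) zero    = simplex k zero
  simplex (suc k) (suc N) = simplex (suc k) N + simplex k (suc N)

  simplex-zero : ∀ k → simplex k 0 ≡ 1
  simplex-zero zero    = refl
  simplex-zero (suc k) = simplex-zero k

  simplex-one : ∀ k → simplex k 1 ≡ suc k
  simplex-one zero    = refl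
  simplex-one (suc k) = cong₂ _+_ (simplex-zero k) (simplex-one k)

  mutual
    simplex-stepʳ : ∀ k N → suc N * simplex k (suc N) ≡ (suc N + k) * simplex k N
    simplex-stepʳ zero    N = cong (_* 1) (sym (+-identityʳ (suc N)))
    simplex-stepʳ (suc k) N = begin
      suc N * (a + b)           ≡⟨ *-distribˡ-+ (suc N) a b ⟩
      suc N * a + suc N * b     ≡⟨ cong (suc N * a +_) (simplex-stepˡ k N) ⟨
      suc N * a + suc k * a     ≡⟨ *-distribʳ-+ a (suc N) (suc k) ⟨
      (suc N + suc k) * a ∎
      where
      open ≡-Reasoning
      a = simplex (suc k) N
      b = simplex k (suc N)

    simplex-stepˡ : ∀ k N → suc k * simplex (suc k) N ≡ suc N * simplex k (suc N)
    simplex-stepˡ k zero = begin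
      suc k * simplex k 0 ≡⟨ cong (suc k *_) (simplex-zero k) ⟩
      suc k * 1           ≡⟨ *-identityʳ (suc k) ⟩
      suc k               ≡⟨ simplex-one k ⟨
      simplex k 1         ≡⟨ +-identityʳ (simplex k 1) ⟨
      1 * simplex k 1 ∎
      where open ≡-Reasoning
    simplex-stepˡ k (suc N) = begin
      suc k * (simplex (suc k) N + b)   ≡⟨ *-distribˡ-+ (suc k) _ b ⟩
      suc k * simplex (suc k) N + suc k * b ≡⟨ cong (_+ suc k * b) (simplex-stepˡ k N) ⟩
      suc N * b + suc k * b             ≡⟨ *-distribʳ-+ b (suc N) (suc k) ⟨
      (suc N + suc k) * b               ≡⟨ cong (_* b) (+-suc (suc N) k) ⟩
      (suc (suc N) + k) * b             ≡⟨ simplex-stepʳ k (suc N) ⟨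
      suc (suc N) * simplex k (suc (suc N)) ∎
      where
      open ≡-Reasoning
      b = simplex k (suc N)

  simplex-≤-suc : ∀ k N → simplex k N ≤ simplex k (suc N)
  simplex-≤-suc zero    N = ≤-refl
  simplex-≤-suc (suc k) N = m≤m+n (simplex (suc k) N) (simplex k (suc N))

  simplex-mono : ∀ k {N N′} → N ≤ N′ → simplex k N ≤ simplex k N′
  simplex-mono k N≤N′ = go (≤⇒≤′ N≤N′)
    where
    go : ∀ {N N′} → N ≤′ N′ → simplex k N ≤ simplex k N′
    go ≤′-refl        = ≤-refl
    go (≤′-step N≤N′) = ≤-trans (go N≤N′) (simplex-≤-suc k _)

  simplex-increment : ∀ k N → suc N * (simplex k (suc N) ∸ simplex k N) ≡ k * simplex k N
  simplex-increment k N = begin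
    suc N * (simplex k (suc N) ∸ simplex k N)                ≡⟨ *-distribˡ-∸ (suc N) (simplex k (suc N)) (simplex k N) ⟩
    suc N * simplex k (suc N) ∸ suc N * simplex k N          ≡⟨ cong (_∸ suc N * simplex k N) (simplex-stepʳ k N) ⟩
    (suc N + k) * simplex k N ∸ suc N * simplex k N          ≡⟨ cong (_∸ suc N * simplex k N) (*-distribʳ-+ (simplex k N) (suc N) k) ⟩
    suc N * simplex k N + k * simplex k N ∸ suc N * simplex k N ≡⟨ m+n∸m≡n (suc N * simplex k N) _ ⟩
    k * simplex k N ∎
    where open ≡-Reasoning

  -- Each of the j steps from K to K + j raises simplex k by at most k * H / (K + 1).
  simplex-telescope : ∀ k K H j → (∀ N → N ≤ K + j → simplex k N ≤ H) →
    suc K * simplex k (K + j) ≤ suc K * simplex k K + j * (k * H)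
  simplex-telescope k K H zero _ rewrite +-identityʳ K = m≤m+n _ _
  simplex-telescope k K H (suc j) ≤H rewrite +-suc K j = begin
    suc K * simplex k (suc N)                   ≡⟨ cong (suc K *_) (m+[n∸m]≡n (simplex-≤-suc k N)) ⟨
    suc K * (simplex k N + D)                   ≡⟨ *-distribˡ-+ (suc K) (simplex k N) D ⟩
    suc K * simplex k N + suc K * D             ≤⟨ +-mono-≤ (simplex-telescope k K H j (λ N′ → ≤H N′ ∘ m≤n⇒m≤1+n)) increment-≤ ⟩
    suc K * simplex k K + j * (k * H) + k * H   ≡⟨ +-assoc (suc K * simplex k K) _ _ ⟩
    suc K * simplex k K + (j * (k * H) + k * H) ≡⟨ cong (suc K * simplex k K +_) (+-comm (j * (k * H)) _) ⟩
    suc K * simplex k K + suc j * (k * H) ∎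
    where
    open ≤-Reasoning
    N = K + j
    D = simplex k (suc N) ∸ simplex k N
    increment-≤ : suc K * D ≤ k * H
    increment-≤ = begin
      suc K * D       ≤⟨ *-monoˡ-≤ D (s≤s (m≤m+n K j)) ⟩
      suc N * D       ≡⟨ simplex-increment k N ⟩
      k * simplex k N ≤⟨ *-monoʳ-≤ k (≤H N (n≤1+n N)) ⟩
      k * H ∎

  ≤ᵇ-cong : ∀ {a b c d} → (a ≤ b → c ≤ d) → (c ≤ d → a ≤ b) → (a ≤ᵇ b) ≡ (c ≤ᵇ d)
  ≤ᵇ-cong {a} {b} {c} {d} ⇒ ⇐ with a ≤ᵇ b | ≤ᵇ-reflects-≤ a b | c ≤ᵇ d | ≤ᵇ-reflects-≤ c d
  ... | true  | _       | true  | _       = refl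
  ... | false | _       | false | _       = refl
  ... | true  | ofʸ a≤b | false | ofⁿ c≰d = ⊥-elim (c≰d (⇒ a≤b))
  ... | false | ofⁿ a≰b | true  | ofʸ c≤d = ⊥-elim (a≰b (⇐ c≤d))

  ≤ᵇ-false : ∀ {a b} → ¬ a ≤ b → (a ≤ᵇ b) ≡ false
  ≤ᵇ-false {a} {b} a≰b with a ≤ᵇ b | ≤ᵇ-reflects-≤ a b
  ... | false | _       = refl
  ... | true  | ofʸ a≤b = ⊥-elim (a≰b a≤b)

  simplexSlice : ℕ → ℕ → ℕ → ℕ
  simplexSlice k N j = if j ≤ᵇ N then simplex k (N ∸ j) else 0

  sumBelow-simplexSlice : ∀ k m N → N < m → sumBelow m (simplexSlice k N) ≡ simplex (suc k) N
  sumBelow-simplexSlice k (suc m) zero    _ = trans (cong (simplex k 0 +_) (sumBelow-zero m)) (+-identityʳ _)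
  sumBelow-simplexSlice k (suc m) (suc N) (s≤s N<m) = begin
    simplex k (suc N) + sumBelow m (simplexSlice k (suc N) ∘ suc)
      ≡⟨ cong (simplex k (suc N) +_) (sumBelow-cong m λ j →
           cong (if_then simplex k (N ∸ j) else 0) (≤ᵇ-cong {suc j} {suc N} s≤s⁻¹ s≤s)) ⟩
    simplex k (suc N) + sumBelow m (simplexSlice k N)
      ≡⟨ cong (simplex k (suc N) +_) (sumBelow-simplexSlice k m N N<m) ⟩
    simplex k (suc N) + simplex (suc k) N ≡⟨ +-comm (simplex k (suc N)) _ ⟩
    simplex (suc k) (suc N) ∎
    where open ≡-Reasoning

  countSum≤ : ℕ → ℕ → ℕ → ℕ
  countSum≤ m k N = sum (map (λ w → indicator (coordSum w ≤ᵇ N)) (allVecs m k))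

  countSum≤-shift : ∀ m k N j →
    sum (map (λ w → indicator (j + coordSum w ≤ᵇ N)) (allVecs m k)) ≡ (if j ≤ᵇ N then countSum≤ m k (N ∸ j) else 0)
  countSum≤-shift m k N j with j ≤ᵇ N | ≤ᵇ-reflects-≤ j N
  ... | true  | ofʸ j≤N = sum-map-cong (λ w → cong indicator (≤ᵇ-cong
                            (λ ≤N → ≤-trans (≤-reflexive (sym (m+n∸m≡n j (coordSum w)))) (∸-monoˡ-≤ j ≤N))
                            (λ ≤N∸j → ≤-trans (+-monoʳ-≤ j ≤N∸j) (≤-reflexive (m+[n∸m]≡n j≤N)))))
                          (allVecs m k)
  ... | false | ofⁿ j≰N = trans (sum-map-cong (λ w → cong indicator (≤ᵇ-false (j≰N ∘ ≤-trans (m≤m+n j (coordSum w)))))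
                                              (allVecs m k))
                                (sum-map-zero (allVecs m k))

  countSum≤≡simplex : ∀ m k N → N < m → countSum≤ m k N ≡ simplex k N
  countSum≤≡simplex m zero    N N<m = refl
  countSum≤≡simplex m (suc k) N N<m = begin
    sum (map (λ w → indicator (coordSum w ≤ᵇ N)) (concatMap (λ a → map (a ∷_) (allVecs m k)) (allFin m)))
      ≡⟨ sum-map-concatMap _ _ (allFin m) ⟩
    sum (map (λ a → sum (map (λ w → indicator (coordSum w ≤ᵇ N)) (map (a ∷_) (allVecs m k)))) (allFin m))
      ≡⟨ sum-map-cong slice (allFin m) ⟩
    sum (map (simplexSlice k N ∘ toℕ) (allFin m)) ≡⟨ sum-map-allFin m (simplexSlice k N) ⟩
    sumBelow m (simplexSlice k N)                 ≡⟨ sumBelow-simplexSlice k m N N<m ⟩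
    simplex (suc k) N ∎
    where
    open ≡-Reasoning
    slice : ∀ a → sum (map (λ w → indicator (coordSum w ≤ᵇ N)) (map (a ∷_) (allVecs m k))) ≡ simplexSlice k N (toℕ a)
    slice a = begin
      sum (map (λ w → indicator (coordSum w ≤ᵇ N)) (map (a ∷_) (allVecs m k)))
        ≡⟨ sum-map-∘ _ (a ∷_) (allVecs m k) ⟨
      sum (map (λ w → indicator (toℕ a + coordSum w ≤ᵇ N)) (allVecs m k))
        ≡⟨ countSum≤-shift m k N (toℕ a) ⟩
      (if toℕ a ≤ᵇ N then countSum≤ m k (N ∸ toℕ a) else 0)
        ≡⟨ cong (λ c → if toℕ a ≤ᵇ N then c else 0) (countSum≤≡simplex m k _ (≤-<-trans (m∸n≤m N (toℕ a)) N<m)) ⟩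
      simplexSlice k N (toℕ a) ∎

  module Slab (K L : ℕ) where

    m : ℕ
    m = K + L

    slab : ∀ {n} → SubsetOf m n
    slab x = inRange K L (coordSum x)

    deg-slab : ∀ {k} (i : Fin (suc k)) (w : Vec (Fin m) k) →
      deg slab i w ≡ sumBelow m (λ j → indicator (inRange K L (coordSum w + j)))
    deg-slab i w = begin
      deg slab i w                                               ≡⟨ length-filterᵇ _ (allFin m) ⟩
      sum (map (λ a → indicator (slab (insertAt w i a))) (allFin m))
        ≡⟨ sum-map-cong (λ a → cong (indicator ∘ inRange K L) (coordSum-insertAt w i a)) (allFin m) ⟩
      sum (map ((λ j → indicator (inRange K L (coordSum w + j))) ∘ toℕ) (allFin m)) ≡⟨ sum-map-allFin m _ ⟩
      sumBelow m (λ j → indicator (inRange K L (coordSum w + j))) ∎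
      where open ≡-Reasoning

    deg-slab-full : ∀ {k} (i : Fin (suc k)) (w : Vec (Fin m) k) → coordSum w ≤ K → deg slab i w ≡ L
    deg-slab-full i w ≤K = begin
      deg slab i w                                            ≡⟨ deg-slab i w ⟩
      sumBelow m (λ j → indicator (inRange K L (σ + j)))
        ≡⟨ sumBelow-cong m (λ j → cong (λ lo → indicator (inRange lo L (σ + j))) (m+[n∸m]≡n ≤K)) ⟨
      sumBelow m (λ j → indicator (inRange (σ + (K ∸ σ)) L (σ + j)))
        ≡⟨ sumBelow-cong m (λ j → cong indicator (inRange-+ σ (K ∸ σ) L j)) ⟩
      sumBelow m (indicator ∘ inRange (K ∸ σ) L) ≡⟨ count-inRange m (K ∸ σ) L (+-monoˡ-≤ L (m∸n≤m K σ)) ⟩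
      L ∎
      where
      open ≡-Reasoning
      σ = coordSum w

    deg-slab-empty : ∀ {k} (i : Fin (suc k)) (w : Vec (Fin m) k) → m ≤ coordSum w → deg slab i w ≡ 0
    deg-slab-empty i w m≤σ = trans (deg-slab i w) (trans (sumBelow-cong m outside) (sumBelow-zero m))
      where
      outside : ∀ j → indicator (inRange K L (coordSum w + j)) ≡ 0
      outside j with inRange K L (coordSum w + j) in eq
      ... | false = refl
      ... | true  = ⊥-elim (<⇒≱ (proj₂ (inRange-sound K L _ (subst T (sym eq) tt))) (≤-trans m≤σ (m≤m+n _ j)))

    L*countSum≤-≤-card : ∀ {k} (i : Fin (suc k)) → L * countSum≤ m k K ≤ card (slab {suc k})
    L*countSum≤-≤-card {k} i = begin
      L * countSum≤ m k K                                        ≡⟨ sum-map-*ˡ L _ (allVecs m k) ⟨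
      sum (map (λ w → L * indicator (coordSum w ≤ᵇ K)) (allVecs m k)) ≤⟨ sum-map-mono-≤ full-lines (allVecs m k) ⟩
      sum (map (deg slab i) (allVecs m k))                       ≡⟨ card≡sum-deg slab i ⟨
      card (slab {suc k}) ∎
      where
      open ≤-Reasoning
      full-lines : ∀ w → L * indicator (coordSum w ≤ᵇ K) ≤ deg slab i w
      full-lines w with coordSum w ≤ᵇ K | ≤ᵇ-reflects-≤ (coordSum w) K
      ... | true  | ofʸ ≤K = ≤-reflexive (trans (*-identityʳ L) (sym (deg-slab-full i w ≤K)))
      ... | false | _      = ≤-trans (≤-reflexive (*-zeroʳ L)) z≤n

    card-proj-≤-countSum≤ : ∀ {k} (i : Fin (suc k)) → card (proj (slab {suc k}) i) ≤ countSum≤ m k (m ∸ 1)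
    card-proj-≤-countSum≤ {k} i = begin
      card (proj slab i)                               ≡⟨ length-filterᵇ _ (allVecs m k) ⟩
      sum (map (indicator ∘ proj slab i) (allVecs m k)) ≤⟨ sum-map-mono-≤ (λ w → indicator-mono (below w)) (allVecs m k) ⟩
      countSum≤ m k (m ∸ 1) ∎
      where
      open ≤-Reasoning
      below : ∀ w → T (proj slab i w) → T (coordSum w ≤ᵇ m ∸ 1)
      below w w∈proj with m ≤? coordSum w
      ... | yes m≤σ rewrite deg-slab-empty i w m≤σ = ⊥-elim w∈proj
      ... | no  m≰σ = ≤⇒≤ᵇ (∸-monoˡ-≤ 1 (≰⇒> m≰σ))

    module _ (0<L : 0 < L) where

      K<m : K < m
      K<m = m<m+n K 0<L

      zeros : ∀ k → Vec (Fin m) k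
      zeros k = replicate k (fromℕ< (≤-<-trans z≤n K<m))

      coordSum-zeros : ∀ k → coordSum (zeros k) ≡ 0
      coordSum-zeros zero    = refl
      coordSum-zeros (suc k) = cong₂ _+_ (toℕ-fromℕ< _) (coordSum-zeros k)

      slab-nonEmpty : ∀ k → NonEmpty (slab {suc k})
      slab-nonEmpty k = fromℕ< K<m ∷ zeros k , inRange-complete K L _ (≤-reflexive (sym σ≡K)) (subst (_< m) (sym σ≡K) K<m)
        where
        σ≡K : toℕ (fromℕ< K<m) + coordSum (zeros k) ≡ K
        σ≡K = trans (cong₂ _+_ (toℕ-fromℕ< K<m) (coordSum-zeros k)) (+-identityʳ K)

      card-proj-pos : ∀ {k} (i : Fin (suc k)) → 1 ≤ card (proj (slab {suc k}) i)
      card-proj-pos {k} i = subst (1 ≤_) (sym (length-filterᵇ _ (allVecs m k)))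
        (sum-indicator-pos (proj slab i) (∈-allVecs (zeros k))
          (<⇒<ᵇ (subst (0 <_) (sym (deg-slab-full i (zeros k) (≤-trans (≤-reflexive (coordSum-zeros k)) z≤n))) 0<L)))

  -- The parabola u ↦ u² − (2c₀ + t)u is symmetric about c₀ + t/2, so its sublevel set through
  -- a point of [c₀, c₀ + t] stays inside [c₀, c₀ + t].
  parabola-sublevel : ∀ c₀ r t u → r ≤ t →
    u * u + (2 * c₀ + t) * (c₀ + r) ≤ (c₀ + r) * (c₀ + r) + (2 * c₀ + t) * u → c₀ ≤ u × u ≤ c₀ + t
  parabola-sublevel c₀ r t u r≤t u≤u₀ = lower , upper
    where
    Sublevel : ℕ → ℕ → ℕ → Set
    Sublevel c₀ t u = u * u + (2 * c₀ + t) * (c₀ + r) ≤ (c₀ + r) * (c₀ + r) + (2 * c₀ + t) * u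
    f = t ∸ r
    t≡ : r + f ≡ t
    t≡ = m+[n∸m]≡n r≤t
    excess : ∀ {P Q y} → P ≡ Q + suc y → Q < P
    excess {Q = Q} refl = m<m+n Q z<s
    lower : c₀ ≤ u
    lower with c₀ ≤? u
    ... | yes c₀≤u = c₀≤u
    ... | no  c₀≰u = ⊥-elim (<⇒≱ (excess (identity u r f e)) (subst₂ (λ c₀ t → Sublevel c₀ t u) (sym c₀≡) (sym t≡) u≤u₀))
      where
      e = c₀ ∸ suc u
      c₀≡ : suc u + e ≡ c₀
      c₀≡ = m+[n∸m]≡n (≰⇒> c₀≰u)
      identity : ∀ u r f e → let c₀ = suc u + e ; t = r + f ; u₀ = c₀ + r in
        u * u + (2 * c₀ + t) * u₀ ≡ u₀ * u₀ + (2 * c₀ + t) * u + suc (r + e) * suc (e + f)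
      identity = solve-∀
    upper : u ≤ c₀ + t
    upper with u ≤? c₀ + t
    ... | yes u≤ = u≤
    ... | no  u≰ = ⊥-elim (<⇒≱ (excess (identity c₀ r f e)) (subst₂ (Sublevel c₀) (sym t≡) (sym u≡) u≤u₀))
      where
      e = u ∸ suc (c₀ + t)
      u≡ : suc (c₀ + (r + f)) + e ≡ u
      u≡ = trans (cong (λ t → suc (c₀ + t) + e) t≡) (m+[n∸m]≡n (≰⇒> u≰))
      identity : ∀ c₀ r f e → let t = r + f ; u = suc (c₀ + t) + e ; u₀ = c₀ + r in
        u * u + (2 * c₀ + t) * u₀ ≡ u₀ * u₀ + (2 * c₀ + t) * u + suc (f + e) * suc (e + r)
      identity = solve-∀

  tilt-parabola : ∀ W a a₀ B c D S₀ Sₐ → Sₐ + D * a₀ ≡ S₀ + D * a →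
    (W + a) * (W + a) + (B * (W + a₀) + c * S₀) ≤ (W + a₀) * (W + a₀) + (B * (W + a) + c * Sₐ) →
    (W + a) * (W + a) + (B + c * D) * (W + a₀) ≤ (W + a₀) * (W + a₀) + (B + c * D) * (W + a)
  tilt-parabola W a a₀ B c D S₀ Sₐ Sₐ≡ le = +-cancelʳ-≤ (c * S₀ + c * D * a) _ _ (begin
    (W + a) * (W + a) + (B + c * D) * (W + a₀) + (c * S₀ + c * D * a)
      ≡⟨ split₁ W a a₀ B c D S₀ ⟩
    (W + a) * (W + a) + (B * (W + a₀) + c * S₀) + c * D * (W + a₀) + c * D * a
      ≤⟨ +-monoˡ-≤ (c * D * a) (+-monoˡ-≤ (c * D * (W + a₀)) le) ⟩
    (W + a₀) * (W + a₀) + (B * (W + a) + c * Sₐ) + c * D * (W + a₀) + c * D * a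
      ≡⟨ split₂ W a a₀ B c D Sₐ ⟩
    (W + a₀) * (W + a₀) + B * (W + a) + c * (Sₐ + D * a₀) + c * D * W + c * D * a
      ≡⟨ cong (λ S → (W + a₀) * (W + a₀) + B * (W + a) + c * S + c * D * W + c * D * a) Sₐ≡ ⟩
    (W + a₀) * (W + a₀) + B * (W + a) + c * (S₀ + D * a) + c * D * W + c * D * a
      ≡⟨ split₃ W a a₀ B c D S₀ ⟩
    (W + a₀) * (W + a₀) + (B + c * D) * (W + a) + (c * S₀ + c * D * a) ∎)
    where
    open ≤-Reasoning
    split₁ : ∀ W a a₀ B c D S₀ →
      (W + a) * (W + a) + (B + c * D) * (W + a₀) + (c * S₀ + c * D * a) ≡
      (W + a) * (W + a) + (B * (W + a₀) + c * S₀) + c * D * (W + a₀) + c * D * a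
    split₁ = solve-∀
    split₂ : ∀ W a a₀ B c D Sₐ →
      (W + a₀) * (W + a₀) + (B * (W + a) + c * Sₐ) + c * D * (W + a₀) + c * D * a ≡
      (W + a₀) * (W + a₀) + B * (W + a) + c * (Sₐ + D * a₀) + c * D * W + c * D * a
    split₂ = solve-∀
    split₃ : ∀ W a a₀ B c D S₀ →
      (W + a₀) * (W + a₀) + B * (W + a) + c * (S₀ + D * a) + c * D * W + c * D * a ≡
      (W + a₀) * (W + a₀) + (B + c * D) * (W + a) + (c * S₀ + c * D * a)
    split₃ = solve-∀

  -≤-⇒+≤+ : ∀ a b c d → ℤ.+ a ℤ.- ℤ.+ b ℤ.≤ ℤ.+ c ℤ.- ℤ.+ d → a + d ≤ c + b
  -≤-⇒+≤+ a b c d le = ℤP.drop‿+≤+ (subst₂ ℤ._≤_ (regroup (ℤ.+ a) (ℤ.+ b) (ℤ.+ d)) (regroup′ (ℤ.+ c) (ℤ.+ d) (ℤ.+ b))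
                                         (ℤP.+-monoˡ-≤ (ℤ.+ b ℤ.+ ℤ.+ d) le))
    where
    regroup : ∀ x y z → (x ℤ.- y) ℤ.+ (y ℤ.+ z) ≡ x ℤ.+ z
    regroup = ZS.solve-∀
    regroup′ : ∀ x y z → (x ℤ.- y) ℤ.+ (z ℤ.+ y) ≡ x ℤ.+ z
    regroup′ = ZS.solve-∀

  deg-≤-window : ∀ {m k} (Y : SubsetOf m (suc k)) (i : Fin (suc k)) (w : Vec (Fin m) k) c len →
    (∀ a → T (Y (insertAt w i a)) → c ≤ coordSum w + toℕ a × coordSum w + toℕ a < c + len) → deg Y i w ≤ len
  deg-≤-window {m} Y i w c len window = begin
    deg Y i w                                                   ≡⟨ length-filterᵇ _ (allFin m) ⟩
    sum (map (λ a → indicator (Y (insertAt w i a))) (allFin m)) ≤⟨ sum-map-mono-≤ (λ a → indicator-mono (shifted a)) (allFin m) ⟩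
    sum (map ((indicator ∘ inRange (c ∸ W) len) ∘ toℕ) (allFin m)) ≡⟨ sum-map-allFin m _ ⟩
    sumBelow m (indicator ∘ inRange (c ∸ W) len)                ≤⟨ count-inRange-≤ m (c ∸ W) len ⟩
    len ∎
    where
    open ≤-Reasoning
    W = coordSum w
    shifted : ∀ a → T (Y (insertAt w i a)) → T (inRange (c ∸ W) len (toℕ a))
    shifted a a∈ = inRange-complete (c ∸ W) len (toℕ a)
      (≤-trans (∸-monoˡ-≤ W c≤) (≤-reflexive (m+n∸m≡n W (toℕ a))))
      (+-cancelˡ-< W (toℕ a) _ (<-≤-trans <c+len (≤-trans (+-monoˡ-≤ len (m≤n+m∸n c W)) (≤-reflexive (+-assoc W (c ∸ W) len)))))
      where
      c≤ = proj₁ (window a a∈)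
      <c+len = proj₂ (window a a∈)

  maximiser : ∀ {m n} (f : Vec (Fin m) n → ℤ) (Y : SubsetOf m n) → NonEmpty Y →
    Σ (Vec (Fin m) n) λ z → T (Y z) × (∀ y → T (Y y) → f y ℤ.≤ f z)
  maximiser {m} {n} f Y (y₀ , y₀∈Y) = z , argmax-all f y₀∈Y (all-filter (T? ∘ Y) ys) , maximal
    where
    ys = allVecs m n
    z = argmax f y₀ (filterᵇ Y ys)
    maximal : ∀ y → T (Y y) → f y ℤ.≤ f z
    maximal y y∈Y = All.lookup (f[xs]≤f[argmax] y₀ (filterᵇ Y ys)) (∈-filter⁺ (T? ∘ Y) (∈-allVecs y) y∈Y)

  block-decomposition : ∀ s′ n r₀ → r₀ < suc s′ * n →
    Σ (Fin n) λ d → Σ ℕ λ r → r ≤ s′ × r₀ ≡ suc s′ * toℕ d + r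
  block-decomposition s′ n r₀ r₀< = fromℕ< q<n , r₀ % s , ≤-pred (m%n<n r₀ s) , (begin
    r₀                      ≡⟨ m≡m%n+[m/n]*n r₀ s ⟩
    r₀ % s + r₀ / s * s     ≡⟨ +-comm (r₀ % s) _ ⟩
    r₀ / s * s + r₀ % s     ≡⟨ cong (λ q → q * s + r₀ % s) (toℕ-fromℕ< q<n) ⟨
    toℕ (fromℕ< q<n) * s + r₀ % s ≡⟨ cong (_+ r₀ % s) (*-comm (toℕ (fromℕ< q<n)) s) ⟩
    s * toℕ (fromℕ< q<n) + r₀ % s ∎)
    where
    open ≡-Reasoning
    s = suc s′
    q<n : r₀ / s < n
    q<n = m<n*o⇒m/o<n (subst (r₀ <_) (*-comm s n) r₀<)

  module NoCore (K s′ k : ℕ) where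

    s n : ℕ
    s = suc s′
    n = suc k

    open Slab K (s * n)

    -- Weighting coordinate d by d makes the potential, restricted to a line in direction d, the
    -- parabola of parabola-sublevel centred in the block [K + s d, K + s d + s′] of coordinate sums.
    potential : Vec (Fin m) n → ℤ
    potential x = ℤ.+ (coordSum x * coordSum x) ℤ.- ℤ.+ ((2 * K + s′) * coordSum x + 2 * s * weightedSum 0 x)

    potential-line : ∀ (w : Vec (Fin m) k) (d : Fin n) (a a₀ : Fin m) r → r ≤ s′ →
      coordSum w + toℕ a₀ ≡ K + s * toℕ d + r →
      potential (insertAt w d a) ℤ.≤ potential (insertAt w d a₀) →
      K + s * toℕ d ≤ coordSum w + toℕ a × coordSum w + toℕ a ≤ K + s * toℕ d + s′
    potential-line w d a a₀ r r≤s′ u₀≡ le = parabola-sublevel c₀ r s′ u r≤s′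
      (subst (λ u₀ → u * u + (2 * c₀ + s′) * u₀ ≤ u₀ * u₀ + (2 * c₀ + s′) * u) u₀≡
        (subst (λ B → u * u + B * (W + toℕ a₀) ≤ (W + toℕ a₀) * (W + toℕ a₀) + B * u) (coefficient K s′ (toℕ d))
          (tilt-parabola W (toℕ a) (toℕ a₀) (2 * K + s′) (2 * s) (toℕ d) S₀ Sₐ (weightedSum-insertAt 0 w d a a₀) compared)))
      where
      W = coordSum w
      u = W + toℕ a
      c₀ = K + s * toℕ d
      Sₐ = weightedSum 0 (insertAt w d a)
      S₀ = weightedSum 0 (insertAt w d a₀)
      compared : u * u + ((2 * K + s′) * (W + toℕ a₀) + 2 * s * S₀) ≤ (W + toℕ a₀) * (W + toℕ a₀) + ((2 * K + s′) * u + 2 * s * Sₐ)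
      compared = subst₂ (λ x y → x * x + ((2 * K + s′) * y + 2 * s * S₀) ≤ y * y + ((2 * K + s′) * x + 2 * s * Sₐ))
        (coordSum-insertAt w d a) (coordSum-insertAt w d a₀) (-≤-⇒+≤+ (σ y * σ y) (β * σ y + 2 * s * Sₐ) (σ y₀ * σ y₀) (β * σ y₀ + 2 * s * S₀) le)
        where
        σ = coordSum {m}
        β = 2 * K + s′
        y = insertAt w d a
        y₀ = insertAt w d a₀
      coefficient : ∀ K s′ d → 2 * K + s′ + 2 * suc s′ * d ≡ 2 * (K + suc s′ * d) + s′
      coefficient = solve-∀

    no-core : ¬ Σ (SubsetOf m n) λ Y → Y ⊆ˢ slab × NonEmpty Y × ((i : Fin n) → suc s ≤ MinDeg Y i)
    no-core (Y , Y⊆slab , Y≠∅ , minDeg>s) = <⇒≱ (s≤s line-≤s) (≤-trans (minDeg>s d) (MinDeg≤deg Y d w z∈line))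
      where
      z = proj₁ (maximiser potential Y Y≠∅)
      z∈Y = proj₁ (proj₂ (maximiser potential Y Y≠∅))
      z-max = proj₂ (proj₂ (maximiser potential Y Y≠∅))
      K≤σ = proj₁ (inRange-sound K (s * n) (coordSum z) (Y⊆slab z z∈Y))
      σ<  = proj₂ (inRange-sound K (s * n) (coordSum z) (Y⊆slab z z∈Y))
      block = block-decomposition s′ n (coordSum z ∸ K) (+-cancelˡ-< K _ _ (subst (_< m) (sym (m+[n∸m]≡n K≤σ)) σ<))
      d = proj₁ block
      r = proj₁ (proj₂ block)
      w = removeAt z d
      a₀ = lookup z d
      z≡ : insertAt w d a₀ ≡ z
      z≡ = insertAt-removeAt z d
      u₀≡ : coordSum w + toℕ a₀ ≡ K + s * toℕ d + r
      u₀≡ = begin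
        coordSum w + toℕ a₀         ≡⟨ coordSum-insertAt w d a₀ ⟨
        coordSum (insertAt w d a₀)  ≡⟨ cong coordSum z≡ ⟩
        coordSum z                  ≡⟨ m+[n∸m]≡n K≤σ ⟨
        K + (coordSum z ∸ K)        ≡⟨ cong (K +_) (proj₂ (proj₂ (proj₂ block))) ⟩
        K + (s * toℕ d + r)         ≡⟨ +-assoc K _ r ⟨
        K + s * toℕ d + r ∎
        where open ≡-Reasoning
      line-≤s : deg Y d w ≤ s
      line-≤s = deg-≤-window Y d w (K + s * toℕ d) s λ a a∈Y →
        let (lo , hi) = potential-line w d a a₀ r (proj₁ (proj₂ (proj₂ block))) u₀≡
                          (subst (λ x → potential (insertAt w d a) ℤ.≤ potential x) (sym z≡) (z-max _ a∈Y))
        in lo , <-≤-trans (s≤s hi) (≤-reflexive (sym (+-suc _ s′)))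
      z∈line : 1 ≤ deg Y d w
      z∈line = subst (1 ≤_) (sym (length-filterᵇ _ (allFin m)))
        (sum-indicator-pos (λ a → Y (insertAt w d a)) (∈-allFin a₀) (subst (T ∘ Y) (sym z≡) z∈Y))

  telescope⇒ratio : ∀ T c H₀ H .{{_ : NonZero c}} → H₀ ≤ H →
    suc (T * c) * H ≤ suc (T * c) * H₀ + c * H → (T ∸ 1) * H ≤ T * H₀
  telescope⇒ratio T c H₀ H H₀≤H telescope = ratio T TΔ≤H
    where
    open ≤-Reasoning
    Δ = H ∸ H₀
    H₀+Δ≡H : H₀ + Δ ≡ H
    H₀+Δ≡H = m+[n∸m]≡n H₀≤H
    increment : suc (T * c) * Δ ≤ c * H
    increment = +-cancelˡ-≤ (suc (T * c) * H₀) _ _ (begin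
      suc (T * c) * H₀ + suc (T * c) * Δ ≡⟨ *-distribˡ-+ (suc (T * c)) H₀ Δ ⟨
      suc (T * c) * (H₀ + Δ)             ≡⟨ cong (suc (T * c) *_) H₀+Δ≡H ⟩
      suc (T * c) * H                    ≤⟨ telescope ⟩
      suc (T * c) * H₀ + c * H ∎)
    TΔ≤H : T * Δ ≤ H
    TΔ≤H = *-cancelˡ-≤ c (begin
      c * (T * Δ)        ≡⟨ *-assoc c T Δ ⟨
      c * T * Δ          ≡⟨ cong (_* Δ) (*-comm c T) ⟩
      T * c * Δ          ≤⟨ *-monoˡ-≤ Δ (n≤1+n (T * c)) ⟩
      suc (T * c) * Δ    ≤⟨ increment ⟩
      c * H ∎)
    ratio : ∀ T → T * Δ ≤ H → (T ∸ 1) * H ≤ T * H₀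
    ratio zero     _      = z≤n
    ratio (suc T′) ≤H = +-cancelʳ-≤ H _ _ (begin
      T′ * H + H               ≡⟨ +-comm (T′ * H) H ⟩
      suc T′ * H               ≡⟨ cong (suc T′ *_) H₀+Δ≡H ⟨
      suc T′ * (H₀ + Δ)        ≡⟨ *-distribˡ-+ (suc T′) H₀ Δ ⟩
      suc T′ * H₀ + suc T′ * Δ ≤⟨ +-monoʳ-≤ (suc T′ * H₀) ≤H ⟩
      suc T′ * H₀ + H ∎)

  density-bound : ∀ s n q H₀ H P c .{{_ : NonZero n}} →
    (n * q ∸ 1) * H ≤ n * q * H₀ → P ≤ H → s * n * H₀ ≤ c → s * (n * q ∸ 1) * P ≤ q * c
  density-bound s n q H₀ H P c ratio P≤H L*H₀≤c = *-cancelˡ-≤ n (begin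
    n * (s * (n * q ∸ 1) * P)   ≡⟨ regroup n s (n * q ∸ 1) P ⟩
    s * n * ((n * q ∸ 1) * P)   ≤⟨ *-monoʳ-≤ (s * n) (*-monoʳ-≤ (n * q ∸ 1) P≤H) ⟩
    s * n * ((n * q ∸ 1) * H)   ≤⟨ *-monoʳ-≤ (s * n) ratio ⟩
    s * n * (n * q * H₀)        ≡⟨ regroup′ (s * n) (n * q) H₀ ⟩
    n * q * (s * n * H₀)        ≤⟨ *-monoʳ-≤ (n * q) L*H₀≤c ⟩
    n * q * c                   ≡⟨ *-assoc n q c ⟩
    n * (q * c) ∎)
    where
    open ≤-Reasoning
    regroup : ∀ n s x P → n * (s * x * P) ≡ s * n * (x * P)
    regroup = solve-∀
    regroup′ : ∀ l t h → l * (t * h) ≡ t * (l * h)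
    regroup′ = solve-∀

  -- Since ε = p / q with p ≥ 1, we have s (n − ε) ≤ s (n − 1/q) = s (n q − 1) / q.
  avgAux-lower-bound : ∀ s n c P (ε : ℚ) → 0ℚ ℚ.< ε → 1 ≤ n → 1 ≤ P →
    s * (n * ↧ₙ ε ∸ 1) * P ≤ ↧ₙ ε * c → (ℤ.+ s ℚ./ 1) ℚ.* ((ℤ.+ n ℚ./ 1) ℚ.- ε) ℚ.≤ avgAux c P
  avgAux-lower-bound s n c P (mkℚ (ℤ.+ zero) _ _) (ℚ.*<* 0<0) _ _ _ = ⊥-elim (ℤP.<-irrefl refl 0<0)
  avgAux-lower-bound s n c (suc P) ε@(mkℚ ℤ.+[1+ p ] q-1 _) _ n≥1 _ bound =
    ℚP.toℚᵘ-cancel-≤ (UP.≤-respʳ-≃ (UP.≃-sym (ℚP.toℚᵘ-fromℚᵘ (U.mkℚᵘ (ℤ.+ c) P)))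
                                  (UP.≤-respˡ-≃ (UP.≃-sym toℚᵘ-lhs) (U.*≤* cross-multiplied)))
    where
    q = suc q-1
    lhs : U.ℚᵘ
    lhs = U.mkℚᵘ (ℤ.+ s) 0 U.* (U.mkℚᵘ (ℤ.+ n) 0 U.- U.mkℚᵘ ℤ.+[1+ p ] q-1)
    toℚᵘ-lhs : ℚ.toℚᵘ ((ℤ.+ s ℚ./ 1) ℚ.* ((ℤ.+ n ℚ./ 1) ℚ.- ε)) U.≃ lhs
    toℚᵘ-lhs = UP.≃-trans (ℚP.toℚᵘ-homo-* (ℤ.+ s ℚ./ 1) _)
                 (UP.*-cong (ℚP.toℚᵘ-fromℚᵘ (U.mkℚᵘ (ℤ.+ s) 0))
                   (UP.≃-trans (ℚP.toℚᵘ-homo-+ (ℤ.+ n ℚ./ 1) (ℚ.- ε))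
                     (UP.+-cong (ℚP.toℚᵘ-fromℚᵘ (U.mkℚᵘ (ℤ.+ n) 0)) (ℚP.toℚᵘ-homo‿- ε))))
    numerator-≤ : ℤ.+ n ℤ.* ℤ.+ q ℤ.+ (ℤ.- ℤ.+[1+ p ]) ℤ.* ℤ.+ 1 ℤ.≤ ℤ.+ (n * q ∸ 1)
    numerator-≤ = begin
      ℤ.+ n ℤ.* ℤ.+ q ℤ.+ (ℤ.- ℤ.+[1+ p ]) ℤ.* ℤ.+ 1 ≡⟨ cong₂ ℤ._+_ (sym (ℤP.pos-* n q)) (ℤP.*-identityʳ ℤ.-[1+ p ]) ⟩
      ℤ.+ (n * q) ℤ.+ ℤ.-[1+ p ]                   ≤⟨ ℤP.+-monoʳ-≤ (ℤ.+ (n * q)) (ℤ.-≤- z≤n) ⟩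
      ℤ.+ (n * q) ℤ.+ ℤ.-[1+ 0 ]                   ≡⟨ ℤP.⊖-≥ (*-mono-≤ n≥1 (s≤s z≤n)) ⟩
      ℤ.+ (n * q ∸ 1) ∎
      where open ℤP.≤-Reasoning
    q≡ : ℤ.+ q ≡ U.↧ lhs
    q≡ = cong (λ x → ℤ.+ suc x) (sym (trans (+-identityʳ (q-1 + 0)) (+-identityʳ q-1)))
    cross-multiplied : ℤ.+ s ℤ.* (ℤ.+ n ℤ.* ℤ.+ q ℤ.+ (ℤ.- ℤ.+[1+ p ]) ℤ.* ℤ.+ 1) ℤ.* ℤ.+ suc P ℤ.≤ ℤ.+ c ℤ.* U.↧ lhs
    cross-multiplied = begin
      ℤ.+ s ℤ.* (ℤ.+ n ℤ.* ℤ.+ q ℤ.+ (ℤ.- ℤ.+[1+ p ]) ℤ.* ℤ.+ 1) ℤ.* ℤ.+ suc P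
        ≤⟨ ℤP.*-monoʳ-≤-nonNeg (ℤ.+ suc P) (ℤP.*-monoˡ-≤-nonNeg (ℤ.+ s) numerator-≤) ⟩
      ℤ.+ s ℤ.* ℤ.+ (n * q ∸ 1) ℤ.* ℤ.+ suc P
        ≡⟨ trans (cong (ℤ._* ℤ.+ suc P) (sym (ℤP.pos-* s _))) (sym (ℤP.pos-* (s * (n * q ∸ 1)) (suc P))) ⟩
      ℤ.+ (s * (n * q ∸ 1) * suc P) ≤⟨ ℤ.+≤+ bound ⟩
      ℤ.+ (q * c)                   ≡⟨ trans (ℤP.pos-* q c) (trans (ℤP.*-comm (ℤ.+ q) (ℤ.+ c)) (cong (ℤ.+ c ℤ.*_) q≡)) ⟩
      ℤ.+ c ℤ.* U.↧ lhs ∎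
      where open ℤP.≤-Reasoning

  module Construction (k₀ s′ : ℕ) (ε : ℚ) where

    k n s L q c K : ℕ
    k = suc k₀
    n = suc k
    s = suc s′
    L = s * n
    q = ↧ₙ ε
    c = (L ∸ 1) * k
    -- With this K, simplex k grows by a factor at most n q / (n q − 1) on [K, K + L).
    K = n * q * c

    open Slab K L public
    open NoCore K s′ k public using (no-core)

    0<L : 0 < L
    0<L = s≤s z≤n

    slab-avgDeg : 0ℚ ℚ.< ε → (i : Fin n) → (ℤ.+ s ℚ./ 1) ℚ.* ((ℤ.+ n ℚ./ 1) ℚ.- ε) ℚ.≤ AvgDeg slab i
    slab-avgDeg 0<ε i = avgAux-lower-bound s n |X| |Xᵢ| ε 0<ε (s≤s z≤n) (card-proj-pos 0<L i)
      (density-bound s n q H₀ H |Xᵢ| |X| ratio |Xᵢ|≤H L*H₀≤|X|)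
      where
      |X| |Xᵢ| H₀ H : ℕ
      |X|  = card (slab {n})
      |Xᵢ| = card (proj slab i)
      H₀   = simplex k K
      H    = simplex k (K + (L ∸ 1))
      ratio : (n * q ∸ 1) * H ≤ n * q * H₀
      ratio = telescope⇒ratio (n * q) c H₀ H (simplex-mono k (m≤m+n K (L ∸ 1)))
        (subst (λ x → suc K * H ≤ suc K * H₀ + x) (sym (*-assoc (L ∸ 1) k H))
          (simplex-telescope k K H (L ∸ 1) (λ _ → simplex-mono k)))
      m∸1≡ : m ∸ 1 ≡ K + (L ∸ 1)
      m∸1≡ = +-∸-assoc K 0<L
      m∸1<m : m ∸ 1 < m
      m∸1<m = subst (_< m) (sym m∸1≡) (+-monoʳ-< K (n<1+n (L ∸ 1)))
      |Xᵢ|≤H : |Xᵢ| ≤ H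
      |Xᵢ|≤H = subst (|Xᵢ| ≤_) (trans (countSum≤≡simplex m k (m ∸ 1) m∸1<m) (cong (simplex k) m∸1≡))
        (card-proj-≤-countSum≤ i)
      L*H₀≤|X| : L * H₀ ≤ |X|
      L*H₀≤|X| = subst (λ x → L * x ≤ |X|) (countSum≤≡simplex m k K (K<m 0<L)) (L*countSum≤-≤-card i)

open import Defs
open import Data.Nat using (ℕ; suc; _≤_; z≤n; s≤s)
open import Data.Fin using (Fin)
open import Data.Integer using (+_)
open import Data.Rational using (ℚ; 0ℚ; _/_; _<_; _*_; _-_) renaming (_≤_ to _≤ℚ_)
open import Data.Product using (Σ; _×_; _,_)
open import Relation.Nullary using (¬_)

theorem3 : (ε : ℚ) → 0ℚ < ε → (n s : ℕ) → 2 ≤ n → 1 ≤ s →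
    Σ ℕ λ m → 1 ≤ m × Σ (SubsetOf m n) λ X → NonEmpty X ×
    ((i : Fin n) → ((+ s) / 1) * (((+ n) / 1) - ε) ≤ℚ AvgDeg X i) ×
    ¬ (Σ (SubsetOf m n) λ Y → Y ⊆ˢ X × NonEmpty Y × ((i : Fin n) → suc s ≤ MinDeg Y i))
theorem3 ε 0<ε (suc (suc k₀)) (suc s′) (s≤s (s≤s z≤n)) (s≤s z≤n) =
  m , s≤s z≤n , slab , slab-nonEmpty 0<L (suc k₀) , slab-avgDeg 0<ε , no-core
  where open SlabConstruction.Construction k₀ s′ ε
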